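{- For every finite simple graph $G$, $$k(G) \ge \theta_e(G) - |V(G)| + p(G).$$
   Context: All graphs are finite and simple; digraphs are finite, without loops or multiple arcs. The competition graph $C(D)$ of a digraph $D$ has vertex set $V(D)$, and two distinct vertices $x,y$ are adjacent in it if and only if there is a vertex $z$ with arcs $(x,z)$ and $(y,z)$ in $D$. For a graph $G$ and an integer $k\ge 0$, "$G$ together with $k$ isolated vertices" is the disjoint union of $G$ with $k$ new isolated vertices. The competition number $k(G)$ is the smallest $k$ such that $G$ together with $k$ isolated vertices is the competition graph of an acyclic digraph. A clique (a vertex set inducing a complete subgraph) covers an edge if it contains both ends of that edge. An edge clique cover of $G$ is a family of cliques covering all edges of $G$. The edge clique cover number $\theta_e(G)$ is the minimum size of an edge clique cover of $G$ ($\theta_e(G)=0$ if $G$ has no edges). The primary predator index $p(G)$ is the maximum, over all acyclic digraphs $D$ whose competition graph is $G$ together with $k(G)$ isolated vertices, of the number of vertices of in-degree $0$ in $D$. -}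

module Defs where

open import Data.Nat using (ℕ; _+_; _≤_)
open import Data.Bool using (Bool; true; false; not; if_then_else_)
open import Data.Fin using (Fin; splitAt)
open import Data.Sum using (_⊎_; inj₁; inj₂)
open import Data.Product using (Σ; _×_; ∃; ∃-syntax)
open import Data.List using (List; length; allFin; map)
open import Data.Bool.ListAction using (all)
open import Data.Nat.ListAction using (sum)
open import Data.Empty using (⊥)
open import Relation.Nullary using (¬_)
open import Relation.Binary.PropositionalEquality using (_≡_; _≢_)
open import Function.Bundles using (_⇔_)

record Graph (n : ℕ) : Set where
  field
    adj     : Fin n → Fin n → Bool
    adj-sym : ∀ x y → adj x y ≡ adj y x
    adj-irr : ∀ x → adj x x ≡ false
open Graph public

record Digraph (m : ℕ) : Set where
  field
    arc     : Fin m → Fin m → Bool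
    arc-irr : ∀ x → arc x x ≡ false
open Digraph public

data Path {m : ℕ} (D : Digraph m) : Fin m → Fin m → Set where
  step : ∀ {x y} → arc D x y ≡ true → Path D x y
  _∷ₚ_ : ∀ {x y z} → arc D x y ≡ true → Path D y z → Path D x z

Acyclic : ∀ {m} → Digraph m → Set
Acyclic {m} D = ∀ (x : Fin m) → ¬ Path D x x

-- Adjacency of "G together with k isolated vertices" on Fin (n + k):
-- the first n vertices carry G, the last k are isolated.
adjIso : ∀ {n} → Graph n → (k : ℕ) → Fin (n + k) → Fin (n + k) → Bool
adjIso {n} G k x y with splitAt n x | splitAt n y
... | inj₁ x' | inj₁ y' = adj G x' y'
... | _       | _       = false

IsCompetitionGraphOf : ∀ {n} → Graph n → (k : ℕ) → Digraph (n + k) → Set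
IsCompetitionGraphOf {n} G k D =
  ∀ (x y : Fin (n + k)) → x ≢ y →
    (adjIso G k x y ≡ true) ⇔ (∃[ z ] (arc D x z ≡ true × arc D y z ≡ true))

Realizes : ∀ {n} → Graph n → (k : ℕ) → Digraph (n + k) → Set
Realizes G k D = Acyclic D × IsCompetitionGraphOf G k D

IsCompetitionNumber : ∀ {n} → Graph n → ℕ → Set
IsCompetitionNumber {n} G k =
  (Σ (Digraph (n + k)) (Realizes G k)) ×
  (∀ k' → Σ (Digraph (n + k')) (Realizes G k') → k ≤ k')

IsClique : ∀ {n} → Graph n → (Fin n → Bool) → Set
IsClique {n} G S =
  ∀ (x y : Fin n) → x ≢ y → S x ≡ true → S y ≡ true → adj G x y ≡ true

Covers : ∀ {n} → (Fin n → Bool) → Fin n → Fin n → Set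
Covers S x y = S x ≡ true × S y ≡ true

data AllCliques {n} (G : Graph n) : List (Fin n → Bool) → Set where
  [] : AllCliques G List.[]
  _∷_ : ∀ {S Ss} → IsClique G S → AllCliques G Ss → AllCliques G (S List.∷ Ss)

data AnyCovers {n} (x y : Fin n) : List (Fin n → Bool) → Set where
  here  : ∀ {S Ss} → Covers S x y → AnyCovers x y (S List.∷ Ss)
  there : ∀ {S Ss} → AnyCovers x y Ss → AnyCovers x y (S List.∷ Ss)

IsEdgeCliqueCover : ∀ {n} → Graph n → List (Fin n → Bool) → Set
IsEdgeCliqueCover {n} G F =
  AllCliques G F × (∀ (x y : Fin n) → adj G x y ≡ true → AnyCovers x y F)

IsEdgeCliqueCoverNumber : ∀ {n} → Graph n → ℕ → Set
IsEdgeCliqueCoverNumber G t =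
  (Σ _ λ F → IsEdgeCliqueCover G F × length F ≡ t) ×
  (∀ F → IsEdgeCliqueCover G F → t ≤ length F)

inDeg0 : ∀ {m} → Digraph m → Fin m → Bool
inDeg0 {m} D v = all (λ z → not (arc D z v)) (allFin m)

numSources : ∀ {m} → Digraph m → ℕ
numSources {m} D = sum (map (λ v → if inDeg0 D v then 1 else 0) (allFin m))

-- p is the primary predator index p(G), given that k = k(G):
-- the maximum number of in-degree-0 vertices over acyclic D with
-- C(D) = G together with k(G) isolated vertices.
IsPrimaryPredatorIndex : ∀ {n} → Graph n → (k : ℕ) → ℕ → Set
IsPrimaryPredatorIndex {n} G k p =
  (Σ (Digraph (n + k)) λ D → Realizes G k D × numSources D ≡ p) ×
  (∀ (D : Digraph (n + k)) → Realizes G k D → numSources D ≤ p)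

module Submission where

-- Let D be any digraph whose competition graph is G
-- together with k isolated vertices.  For a
-- vertex z of D, the predators of z lying in V(G) pairwise compete for z, so
-- they form a clique of G; and every edge xy of G has a common prey z, whose
-- predator clique then covers xy.  A vertex with a predator has positive
-- in-degree, so the predator cliques of the NON-source vertices of D already
-- form an edge clique cover of G.  There are (n + k) - sources(D) of them,
-- whence  θ_e(G) + sources(D) ≤ n + k  for every such D.
--
-- Theorem 3.4 is this bound applied to a digraph attaining p(G).

open import Defs
open import Data.Nat using (ℕ; suc; _+_; _≤_)
open import Data.Nat.Properties using (+-comm; +-suc; +-monoˡ-≤; ≤-reflexive; ≤-trans)
open import Data.Bool using (Bool; true; false; not; if_then_else_; T; _≟_)
open import Data.Empty using (⊥; ⊥-elim)
open import Data.Fin using (Fin; _↑ˡ_)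
open import Data.Fin.Properties using (splitAt-↑ˡ; ↑ˡ-injective)
open import Data.Product using (_×_; _,_; ∃-syntax)
open import Data.List using (List; []; _∷_; length; allFin; map; filter)
open import Data.List.Properties using (length-map; length-tabulate)
open import Data.List.Relation.Unary.Any using (here; there)
open import Data.List.Relation.Unary.All using (All; lookup)
open import Data.List.Relation.Unary.All.Properties using (all⁺)
open import Data.List.Membership.Propositional using (_∈_)
open import Data.List.Membership.Propositional.Properties using (∈-allFin; ∈-map⁺; ∈-map⁻; ∈-filter⁺)
open import Data.Nat.ListAction using (sum)
open import Relation.Binary.PropositionalEquality using (_≡_; _≢_; refl; sym; trans; cong; subst; subst₂; module ≡-Reasoning)
open import Function.Bundles using (Equivalence; _⇔_)

allCliques-∈ : ∀ {n} {G : Graph n} (F : List (Fin n → Bool)) →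
  (∀ {S} → S ∈ F → IsClique G S) → AllCliques G F
allCliques-∈ []      cliqueAt = []
allCliques-∈ (S ∷ F) cliqueAt = cliqueAt (here refl) ∷ allCliques-∈ F (λ S∈F → cliqueAt (there S∈F))

anyCovers-∈ : ∀ {n} {x y : Fin n} {S : Fin n → Bool} {F : List (Fin n → Bool)} →
  S ∈ F → Covers S x y → AnyCovers x y F
anyCovers-∈ (here refl) cov = here cov
anyCovers-∈ (there S∈F) cov = there (anyCovers-∈ S∈F cov)

length-filter-false+count : ∀ {A : Set} (f : A → Bool) (xs : List A) →
  length (filter (λ x → f x ≟ false) xs) + sum (map (λ x → if f x then 1 else 0) xs)
    ≡ length xs
length-filter-false+count f [] = refl
length-filter-false+count f (x ∷ xs) with f x
... | true  = trans (+-suc _ _) (cong suc (length-filter-false+count f xs))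
... | false = cong suc (length-filter-false+count f xs)

adjIso-↑ˡ : ∀ {n} (G : Graph n) (k : ℕ) (x y : Fin n) →
  adjIso G k (x ↑ˡ k) (y ↑ˡ k) ≡ adj G x y
adjIso-↑ˡ {n} G k x y rewrite splitAt-↑ˡ n x k | splitAt-↑ˡ n y k = refl

module PredatorCliques {n k : ℕ} (G : Graph n) (D : Digraph (n + k))
                       (compGraph : IsCompetitionGraphOf G k D) where

  predators : Fin (n + k) → Fin n → Bool
  predators z x = arc D (x ↑ˡ k) z

  nonSources : List (Fin (n + k))
  nonSources = filter (λ v → inDeg0 D v ≟ false) (allFin (n + k))

  predatorCover : List (Fin n → Bool)
  predatorCover = map predators nonSources

  prey⇒nonSource : ∀ {w z} → arc D w z ≡ true → inDeg0 D z ≡ false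
  prey⇒nonSource {w} {z} w→z with inDeg0 D z in source
  ... | false = refl
  ... | true  = ⊥-elim (absurd (lookup noPredator (∈-allFin w)))
    where
    noPredator : All (λ u → T (not (arc D u z))) (allFin (n + k))
    noPredator = all⁺ (λ u → not (arc D u z)) (allFin (n + k)) (subst T (sym source) _)
    absurd : T (not (arc D w z)) → ⊥
    absurd notArc rewrite w→z = notArc

  adjacent⇔commonPrey : ∀ {x y : Fin n} → x ≢ y →
    adj G x y ≡ true ⇔ (∃[ z ] (predators z x ≡ true × predators z y ≡ true))
  adjacent⇔commonPrey {x} {y} x≢y =
    subst (λ b → (b ≡ true) ⇔ _) (adjIso-↑ˡ G k x y)
      (compGraph (x ↑ˡ k) (y ↑ˡ k) (λ eq → x≢y (↑ˡ-injective k x y eq)))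

  predators-clique : ∀ z → IsClique G (predators z)
  predators-clique z x y x≢y zx zy = Equivalence.from (adjacent⇔commonPrey x≢y) (z , zx , zy)

  edge-covered : ∀ x y → adj G x y ≡ true → AnyCovers x y predatorCover
  edge-covered x y xy with Equivalence.to (adjacent⇔commonPrey x≢y) xy
    where
    x≢y : x ≢ y
    x≢y refl with () ← trans (sym (adj-irr G x)) xy
  ... | z , zx , zy =
    anyCovers-∈ (∈-map⁺ predators (∈-filter⁺ _ (∈-allFin z) (prey⇒nonSource zx))) (zx , zy)

  predatorCover-isCover : IsEdgeCliqueCover G predatorCover
  predatorCover-isCover = allCliques-∈ predatorCover cliqueAt , edge-covered
    where
    cliqueAt : ∀ {S} → S ∈ predatorCover → IsClique G S
    cliqueAt S∈F with z , _ , refl ← ∈-map⁻ predators S∈F = predators-clique z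

  predatorCover-length : length predatorCover + numSources D ≡ n + k
  predatorCover-length = begin
    length predatorCover + numSources D
      ≡⟨ cong (_+ numSources D) (length-map predators nonSources) ⟩
    length nonSources + numSources D
      ≡⟨ length-filter-false+count (inDeg0 D) (allFin (n + k)) ⟩
    length (allFin (n + k))
      ≡⟨ length-tabulate _ ⟩
    n + k ∎
    where open ≡-Reasoning

  θ+sources≤ : ∀ {θ} → IsEdgeCliqueCoverNumber G θ → θ + numSources D ≤ n + k
  θ+sources≤ (_ , θ-minimal) =
    ≤-trans (+-monoˡ-≤ (numSources D) (θ-minimal predatorCover predatorCover-isCover))
            (≤-reflexive predatorCover-length)

theorem3p4 : ∀ (n : ℕ) (G : Graph n) (k θ p : ℕ) →
    IsCompetitionNumber G k →
    IsEdgeCliqueCoverNumber G θ →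
    IsPrimaryPredatorIndex G k p →
    θ + p ≤ k + n
theorem3p4 n G k θ p _ θ-number ((D , (_ , compGraph) , sources≡p) , _) =
  subst₂ _≤_ (cong (θ +_) sources≡p) (+-comm n k)
    (PredatorCliques.θ+sources≤ G D compGraph θ-number)
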